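{- Let $b\ge2$ be an integer and $n$ a non-negative integer. Then every coefficient of the base $b$ expansion of $n\oplus_{ -b}(-n)$ is either $0$ or $1$.
   Context: Every integer $\alpha$ can be written uniquely as $\alpha=\sum_{i\ge0}a_i(-b)^i$ with $a_i\in\{0,\dots,b-1\}$ and only finitely many nonzero. For integers $\alpha=\sum_{i\ge0}a_i(-b)^i$ and $\beta=\sum_{i\ge0}b_i(-b)^i$ written this way, define $\alpha\oplus_{ -b}\beta=\sum_{i\ge0}\bigl((a_i+b_i)\bmod b\bigr)b^i$ (a non-negative integer written in base $b$), where $x\bmod b$ denotes the unique $r$ with $0\le r<b$ and $b\mid x-r$. -}

module Defs where

open import Data.Nat using (ℕ; zero; suc; _<_; NonZero)
open import Data.Nat.DivMod using (_%_)
open import Data.Integer as ℤ using (ℤ; +_)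
open import Data.List using (List; []; _∷_)
open import Data.List.Relation.Unary.All using (All)
open import Relation.Binary.PropositionalEquality using (_≡_)

evalNeg : ℕ → List ℕ → ℤ
evalNeg b []       = + 0
evalNeg b (a ∷ as) = + a ℤ.+ (ℤ.- (+ b)) ℤ.* evalNeg b as

evalPos : ℕ → List ℕ → ℕ
evalPos b []       = 0
evalPos b (a ∷ as) = a Data.Nat.+ b Data.Nat.* evalPos b as

-- ds is a (-b)-ary representation of α: all digits in {0,…,b-1}
-- and Σ dᵢ (-b)^i = α.  (Unique up to trailing zeros.)
record NegRep (b : ℕ) (α : ℤ) (ds : List ℕ) : Set where
  field
    digits<b : All (_< b) ds
    value    : evalNeg b ds ≡ α

-- digitwise sum mod b, padding the shorter list with zeros:
-- the i-th entry is (aᵢ + bᵢ) mod b, i.e. the i-th base-b digit of α ⊕_{-b} β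
⊕digits : (b : ℕ) → .{{NonZero b}} → List ℕ → List ℕ → List ℕ
⊕digits b []       []       = []
⊕digits b []       (y ∷ ys) = (y % b) ∷ ⊕digits b [] ys
⊕digits b (x ∷ xs) []       = (x % b) ∷ ⊕digits b xs []
⊕digits b (x ∷ xs) (y ∷ ys) = ((x Data.Nat.+ y) % b) ∷ ⊕digits b xs ys

{-# OPTIONS --safe #-}
-- Read n ⊕ (-n) as a digitwise addition in base -b.  If the values of two
-- (-b)-ary digit strings add up to a carry c ∈ {0,1}, their lowest digits
-- satisfy a + e = c + b·c', where c' is the sum of the values of the tails.
-- As 0 ≤ a + e ≤ 2b - 2 and c < b, the new carry c' again lies in {0,1} and
-- (a + e) mod b = c.  Since n + (-n) = 0, induction from carry 0 shows that
-- every digit of the sum is a carry, hence 0 or 1.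
module Submission where

open import Defs
open import Data.Nat using (ℕ; suc; _+_; _*_; _≤_; _≥_; _<_; z≤n; s≤s; NonZero)
open import Data.Nat.Properties
  using (≤-pred; <⇒≱; ≤-trans; m≤n+m; m≤m*n; +-mono-<; +-identityʳ; *-comm; *-cancelʳ-<; module ≤-Reasoning)
open import Data.Nat.DivMod using (_%_; [m+kn]%n≡m%n; m<n⇒m%n≡m)
open import Data.Integer as ℤ using (ℤ; +_; -_; -[1+_])
import Data.Integer.Properties as ℤ
open import Data.Integer.Tactic.RingSolver using (solve-∀)
open import Data.List using (List; []; _∷_)
open import Data.List.Relation.Unary.All using (All; []; _∷_)
open import Data.Product using (Σ-syntax; _×_; _,_)
open import Data.Sum using (_⊎_; inj₁; inj₂)
open import Data.Empty using (⊥-elim)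
open import Relation.Binary.PropositionalEquality using (_≡_; refl; sym; trans; cong; cong₂; subst; module ≡-Reasoning)

Bit : ℕ → Set
Bit c = c ≡ 0 ⊎ c ≡ 1

≤1⇒Bit : ∀ {c} → c ≤ 1 → Bit c
≤1⇒Bit z≤n       = inj₁ refl
≤1⇒Bit (s≤s z≤n) = inj₂ refl

Bit⇒≤1 : ∀ {c} → Bit c → c ≤ 1
Bit⇒≤1 (inj₁ refl) = z≤n
Bit⇒≤1 (inj₂ refl) = s≤s z≤n

digitSum-carry≤1 : ∀ {a e k s b} → a < b → e < b → a + e ≡ k + s * b → s ≤ 1
digitSum-carry≤1 {a} {e} {k} {s} {b} a<b e<b eq = ≤-pred (*-cancelʳ-< b s 2 s*b<2*b)
  where
  open ≤-Reasoning
  s*b<2*b : s * b < 2 * b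
  s*b<2*b = begin-strict
    s * b        ≤⟨ m≤n+m (s * b) k ⟩
    k + s * b    ≡⟨ sym eq ⟩
    a + e        <⟨ +-mono-< a<b e<b ⟩
    b + b        ≡⟨ cong (_+_ b) (sym (+-identityʳ b)) ⟩
    2 * b        ∎

%-unique : ∀ {m k s b} .{{_ : NonZero b}} → k < b → m ≡ k + s * b → m % b ≡ k
%-unique {k = k} {s} {b} k<b refl = trans ([m+kn]%n≡m%n k s b) (m<n⇒m%n≡m k<b)

carry-nonNegative : ∀ {m k b} (C : ℤ) → k < b
  → + m ≡ + k ℤ.+ + b ℤ.* C → Σ[ s ∈ ℕ ] (C ≡ + s × m ≡ k + s * b)
carry-nonNegative {k = k} {b} (+ s) _ eq = s , refl , ℤ.+-injective (trans eq pos-linear)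
  where
  pos-linear : + k ℤ.+ + b ℤ.* + s ≡ + (k + s * b)
  pos-linear = sym (trans (ℤ.pos-+ k (s * b)) (cong (ℤ._+_ (+ k)) (trans (cong +_ (*-comm s b)) (ℤ.pos-* b s))))
carry-nonNegative {m} {k} {b} -[1+ t ] k<b eq = ⊥-elim (<⇒≱ k<b b≤k)
  where
  cancel : ∀ K B T → K ℤ.+ B ℤ.* (- T) ℤ.+ B ℤ.* T ≡ K
  cancel = solve-∀
  m+b*t≡k : m + b * suc t ≡ k
  m+b*t≡k = ℤ.+-injective (begin
    + (m + b * suc t)                            ≡⟨ ℤ.pos-+ m (b * suc t) ⟩
    + m ℤ.+ + (b * suc t)                        ≡⟨ cong (ℤ._+_ (+ m)) (ℤ.pos-* b (suc t)) ⟩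
    + m ℤ.+ + b ℤ.* + suc t                      ≡⟨ cong (ℤ._+ + b ℤ.* + suc t) eq ⟩
    + k ℤ.+ + b ℤ.* -[1+ t ] ℤ.+ + b ℤ.* + suc t ≡⟨ cancel (+ k) (+ b) (+ suc t) ⟩
    + k                                          ∎)
    where open ≡-Reasoning
  b≤k : b ≤ k
  b≤k = subst (b ≤_) m+b*t≡k (≤-trans (m≤m*n b (suc t)) (m≤n+m (b * suc t) m))

evalNeg-0∷[] : ∀ b → evalNeg b (0 ∷ []) ≡ + 0
evalNeg-0∷[] b = trans (ℤ.+-identityˡ _) (ℤ.*-zeroʳ (- (+ b)))

lowestDigits-sum : ∀ b x y xs ys c → evalNeg b (x ∷ xs) ℤ.+ evalNeg b (y ∷ ys) ≡ + c
  → + (x + y) ≡ + c ℤ.+ + b ℤ.* (evalNeg b xs ℤ.+ evalNeg b ys)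
lowestDigits-sum b x y xs ys c eq = begin
  + (x + y)                                                        ≡⟨ ℤ.pos-+ x y ⟩
  + x ℤ.+ + y                                                      ≡⟨ regroup (+ x) (+ y) (+ b) u v ⟩
  evalNeg b (x ∷ xs) ℤ.+ evalNeg b (y ∷ ys) ℤ.+ + b ℤ.* (u ℤ.+ v) ≡⟨ cong (ℤ._+ + b ℤ.* (u ℤ.+ v)) eq ⟩
  + c ℤ.+ + b ℤ.* (u ℤ.+ v)                                        ∎
  where
  open ≡-Reasoning
  u v : ℤ
  u = evalNeg b xs
  v = evalNeg b ys
  regroup : ∀ X Y B U V → X ℤ.+ Y ≡ (X ℤ.+ (- B) ℤ.* U) ℤ.+ (Y ℤ.+ (- B) ℤ.* V) ℤ.+ B ℤ.* (U ℤ.+ V)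
  regroup = solve-∀

evalNeg-carry : ∀ {b} .{{_ : NonZero b}} {x y c} xs ys → x < b → y < b → c < b
  → evalNeg b (x ∷ xs) ℤ.+ evalNeg b (y ∷ ys) ≡ + c
  → (x + y) % b ≡ c × Σ[ c′ ∈ ℕ ] (Bit c′ × evalNeg b xs ℤ.+ evalNeg b ys ≡ + c′)
evalNeg-carry {b} {x} {y} {c} xs ys x<b y<b c<b eq
  with s , tails≡s , x+y≡c+sb ← carry-nonNegative (evalNeg b xs ℤ.+ evalNeg b ys) c<b (lowestDigits-sum b x y xs ys c eq)
  = %-unique {s = s} c<b x+y≡c+sb , s , ≤1⇒Bit (digitSum-carry≤1 {s = s} x<b y<b x+y≡c+sb) , tails≡s

module _ {b : ℕ} .{{_ : NonZero b}} (b≥2 : 2 ≤ b) where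

  bit-step : ∀ {x y c} xs ys → x < b → y < b → Bit c
    → evalNeg b (x ∷ xs) ℤ.+ evalNeg b (y ∷ ys) ≡ + c
    → Bit ((x + y) % b) × Σ[ c′ ∈ ℕ ] (Bit c′ × evalNeg b xs ℤ.+ evalNeg b ys ≡ + c′)
  bit-step xs ys x<b y<b c-bit eq with digit≡c , tails ← evalNeg-carry xs ys x<b y<b (≤-trans (s≤s (Bit⇒≤1 c-bit)) b≥2) eq
    = subst Bit (sym digit≡c) c-bit , tails

  0<b : 0 < b
  0<b = ≤-trans (s≤s z≤n) b≥2

  ⊕digits-bits : ∀ {c} xs ys → All (_< b) xs → All (_< b) ys
    → Bit c → evalNeg b xs ℤ.+ evalNeg b ys ≡ + c → All Bit (⊕digits b xs ys)
  ⊕digits-bits [] [] _ _ _ _ = []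
  ⊕digits-bits [] (y ∷ ys) _ (y<b ∷ ys<b) c-bit eq
    with digit , _ , c′-bit , eq′ ← bit-step [] ys 0<b y<b c-bit
           (trans (cong (ℤ._+ evalNeg b (y ∷ ys)) (evalNeg-0∷[] b)) eq)
    = digit ∷ ⊕digits-bits [] ys [] ys<b c′-bit eq′
  ⊕digits-bits (x ∷ xs) [] (x<b ∷ xs<b) _ c-bit eq
    with digit , _ , c′-bit , eq′ ← bit-step xs [] x<b 0<b c-bit
           (trans (cong (ℤ._+_ (evalNeg b (x ∷ xs))) (evalNeg-0∷[] b)) eq)
    = subst Bit (cong (_% b) (+-identityʳ x)) digit ∷ ⊕digits-bits xs [] xs<b [] c′-bit eq′
  ⊕digits-bits (x ∷ xs) (y ∷ ys) (x<b ∷ xs<b) (y<b ∷ ys<b) c-bit eq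
    with digit , _ , c′-bit , eq′ ← bit-step xs ys x<b y<b c-bit eq
    = digit ∷ ⊕digits-bits xs ys xs<b ys<b c′-bit eq′

corollary1 : (b : ℕ) → .{{_ : NonZero b}} → b ≥ 2 → (n : ℕ)
    → (ds es : List ℕ) → NegRep b (+ n) ds → NegRep b (- (+ n)) es
    → All (λ c → c ≡ 0 ⊎ c ≡ 1) (⊕digits b ds es)
corollary1 b b≥2 n ds es ds-rep es-rep =
  ⊕digits-bits b≥2 ds es (NegRep.digits<b ds-rep) (NegRep.digits<b es-rep) (inj₁ refl)
    (trans (cong₂ ℤ._+_ (NegRep.value ds-rep) (NegRep.value es-rep)) (ℤ.+-inverseʳ (+ n)))
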